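{- Let $n,q\ge 2$ be integers... more precisely: let $n\ge 1$ and $q\ge 2$ be integers and let $f$ be a $(b,c)$-coloring of the Hamming graph $H(n,q)$. Put $b'=\frac{b}{\gcd(b,c)}$ and $c'=\frac{c}{\gcd(b,c)}$. Then $b'+c'$ divides $q^{\,n-\frac{b+c}{q}+1}$.
   Context: The Hamming graph $H(n,q)$ has vertex set $\mathbb{Z}_q^n$; two vertices are adjacent iff they differ in exactly one coordinate (it is $n(q-1)$-regular). A perfect $k$-coloring of a graph is a surjective map $f$ from the vertex set onto $\{1,\dots,k\}$ such that there are constants $s_{ij}$ with every vertex of color $i$ having exactly $s_{ij}$ neighbors of color $j$; $S=(s_{ij})$ is its quotient matrix. A $(b,c)$-coloring of $H(n,q)$ is a perfect $2$-coloring with quotient matrix $\begin{pmatrix} a & b\\ c& d\end{pmatrix}$, where $a=n(q-1)-b$, $d=n(q-1)-c$ (so $b,c\ge 1$). For such a coloring $b+c$ is a multiple of $q$, so the exponent is an integer. -}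

module Defs where

open import Data.Nat using (ℕ; zero; suc; _+_; _*_; _∸_; _≤_; NonZero; ≢-nonZero)
open import Data.Nat.GCD using (gcd; gcd[m,n]≢0)
open import Data.Nat.DivMod using (_/_)
open import Data.Fin using (Fin)
open import Data.Fin.Properties using (_≟_)
open import Data.Vec using (Vec; []; _∷_; allFin; zipWith; toList)
open import Data.List using (List; []; _∷_; concatMap; map; length; filter)
open import Data.List.Relation.Unary.All using (All)
open import Data.Product using (_×_; _,_; ∃)
open import Data.Sum using (inj₁)
open import Relation.Nullary using (¬_; Dec; yes; no)
open import Relation.Nullary.Decidable using (¬?; _×-dec_)
open import Relation.Binary.PropositionalEquality using (_≡_; _≢_; refl)

Vertex : ℕ → ℕ → Set
Vertex n q = Vec (Fin q) n

dist : ∀ {n q} → Vertex n q → Vertex n q → ℕ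
dist [] [] = 0
dist (x ∷ xs) (y ∷ ys) with x ≟ y
... | yes _ = dist xs ys
... | no  _ = suc (dist xs ys)

Adjacent : ∀ {n q} → Vertex n q → Vertex n q → Set
Adjacent x y = dist x y ≡ 1

adjacent? : ∀ {n q} (x y : Vertex n q) → Dec (Adjacent x y)
adjacent? x y = Data.Nat._≟_ (dist x y) 1

allVertices : ∀ n q → List (Vertex n q)
allVertices zero    q = [] ∷ []
allVertices (suc n) q =
  concatMap (λ a → map (a ∷_) (allVertices n q)) (toList (allFin q))

nbrsOfColour : ∀ {n q k} → (Vertex n q → Fin k) → Vertex n q → Fin k → ℕ
nbrsOfColour {n} {q} f x j =
  length (filter (λ y → adjacent? x y ×-dec (f y ≟ j)) (allVertices n q))

IsPerfectColouring : ∀ {n q k} → (Vertex n q → Fin k) → (Fin k → Fin k → ℕ) → Set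
IsPerfectColouring {n} {q} {k} f S =
  (∀ (j : Fin k) → ∃ λ (x : Vertex n q) → f x ≡ j)
  × (∀ (x : Vertex n q) (j : Fin k) → nbrsOfColour f x j ≡ S (f x) j)

-- Quotient matrix ( a b ; c d ) with a = n(q-1) - b, d = n(q-1) - c.
-- Colour 1 is Fin.zero, colour 2 is Fin.suc Fin.zero.
bcMatrix : ℕ → ℕ → ℕ → ℕ → Fin 2 → Fin 2 → ℕ
bcMatrix n q b c Fin.zero          Fin.zero          = n * (q ∸ 1) ∸ b
bcMatrix n q b c Fin.zero          (Fin.suc Fin.zero) = b
bcMatrix n q b c (Fin.suc Fin.zero) Fin.zero          = c
bcMatrix n q b c (Fin.suc Fin.zero) (Fin.suc Fin.zero) = n * (q ∸ 1) ∸ c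

IsBCColouring : ∀ {n q} → ℕ → ℕ → (Vertex n q → Fin 2) → Set
IsBCColouring {n} {q} b c f =
  1 ≤ b × 1 ≤ c
  × IsPerfectColouring f (bcMatrix n q b c)

reduceBy : (b c m : ℕ) → 1 ≤ b → ℕ
reduceBy (suc b) c m _ =
  _/_ m (gcd (suc b) c) {{≢-nonZero (gcd[m,n]≢0 (suc b) c (inj₁ (λ ())))}}

module Submission where

-- Let f be a (b,c)-colouring of H(n,q), put B = b + c and let
-- N(p) be the number of vertices of colour 1 in a face p of the cube Z_q^n
-- (a face fixes some coordinates and leaves the others free).  We show
--
--     B · N(p) = c · q^(free p)     whenever  (fixed p) · q < B,           (★)
--
-- i.e. colour 1 has density exactly c/B in every face with few fixed
-- coordinates.  Double counting the edges leaving a face p gives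
-- B·N(p) + R(p) = (fixed p)·q·N(p) + c·q^(free p), where R(p) sums N over the
-- faces obtained by releasing one fixed coordinate of p; inducting on the
-- number of fixed coordinates, R(p) is known and (★) follows by cancelling
-- the positive factor B - (fixed p)·q.  Applying (★) to a face with
-- ⌊B/q⌋ - 1 fixed coordinates gives (b+c)·N = c·q^(n+1-⌊B/q⌋); dividing by
-- gcd(b,c) and using that b′+c′ is coprime to c′ yields the theorem.

open import Defs
open import Data.Nat using (ℕ; zero; suc; pred; _+_; _*_; _∸_; _^_; _≤_; _<_; NonZero; z≤n; s≤s; ≢-nonZero; >-nonZero; >-nonZero⁻¹)
open import Data.Nat.Properties
open import Data.Nat.Divisibility using (_∣_; divides; ∣-trans; m∣m*n)
open import Data.Nat.DivMod using (_/_; m/n*n≤m; m/n*n≡m)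
open import Data.Nat.GCD using (gcd; gcd[m,n]∣m; gcd[m,n]∣n; gcd[m,n]≢0)
open import Data.Nat.Coprimality using (Coprime; coprime-/gcd; coprime-+; coprime-divisor)
open import Data.Nat.Tactic.RingSolver using (solve-∀)
open import Algebra.Properties.Semiring.Sum +-*-semiring
  using (sum; sum-cong-≗; ∑-distrib-+; ∑-comm; *-distribˡ-sum; sum-replicate-zero)
open import Algebra.Properties.CommutativeSemigroup *-commutativeSemigroup using (x∙yz≈y∙xz)
open import Data.Bool using (true; false; if_then_else_)
open import Data.Fin using (Fin; zero; suc)
import Data.Fin.Properties as Fin
open import Data.Maybe using (Maybe; just; nothing)
open import Data.Vec using (Vec; []; _∷_; allFin; toList; tabulate)
open import Data.List using (List; []; _∷_; _++_; map; concatMap; length; filter)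
open import Data.List.Properties using (length-map)
open import Data.List.Relation.Unary.All as All using (All; []; _∷_)
import Data.List.Relation.Unary.All.Properties as All
open import Data.Product using (_×_; _,_; proj₁)
open import Data.Sum using (inj₁)
open import Relation.Nullary using (Dec; yes; no; does)
open import Relation.Nullary.Decidable using (_×-dec_)
open import Relation.Unary using (Decidable)
open import Relation.Binary.PropositionalEquality
open import Function using (_∘_)
open import Data.Empty using (⊥-elim)

private variable
  A A′ : Set

-- The 0/1 indicator of a decided proposition.  It only inspects the boolean
-- 'does', so e.g. 𝟙 (suc x ≟ suc y) and 𝟙 (x ≟ y) agree definitionally.
𝟙 : ∀ {p} {P : Set p} → Dec P → ℕ
𝟙 d = if does d then 1 else 0

𝟙-× : ∀ {p r} {P : Set p} {R : Set r} (dp : Dec P) (dr : Dec R) → 𝟙 (dp ×-dec dr) ≡ 𝟙 dp * 𝟙 dr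
𝟙-× (yes _) (yes _) = refl
𝟙-× (yes _) (no _)  = refl
𝟙-× (no _)  _       = refl

sum-const : ∀ k c → sum {k} (λ _ → c) ≡ k * c
sum-const zero    c = refl
sum-const (suc k) c = cong (c +_) (sum-const k c)

sum-δ : ∀ {k} (x : Fin k) (w : Fin k → ℕ) → sum (λ a → 𝟙 (x Fin.≟ a) * w a) ≡ w x
sum-δ {suc k} zero    w = trans (cong (w zero + 0 +_) (sum-replicate-zero k)) (trans (+-identityʳ _) (+-identityʳ _))
sum-δ {suc k} (suc x) w = sum-δ x (w ∘ suc)

listSum : (A → ℕ) → List A → ℕ
listSum g []       = 0
listSum g (x ∷ xs) = g x + listSum g xs

listSum-++ : (g : A → ℕ) (xs ys : List A) → listSum g (xs ++ ys) ≡ listSum g xs + listSum g ys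
listSum-++ g []       ys = refl
listSum-++ g (x ∷ xs) ys = trans (cong (g x +_) (listSum-++ g xs ys)) (sym (+-assoc (g x) _ _))

listSum-map : (g : A′ → ℕ) (k : A → A′) (xs : List A) → listSum g (map k xs) ≡ listSum (g ∘ k) xs
listSum-map g k []       = refl
listSum-map g k (x ∷ xs) = cong (g (k x) +_) (listSum-map g k xs)

listSum-concatMap : (g : A′ → ℕ) (k : A → List A′) (xs : List A) →
                    listSum g (concatMap k xs) ≡ listSum (listSum g ∘ k) xs
listSum-concatMap g k []       = refl
listSum-concatMap g k (x ∷ xs) =
  trans (listSum-++ g (k x) (concatMap k xs)) (cong (listSum g (k x) +_) (listSum-concatMap g k xs))

listSum-tabulate : ∀ {k} (t : Fin k → A) (g : A → ℕ) → listSum g (toList (tabulate t)) ≡ sum (g ∘ t)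
listSum-tabulate {k = zero}  t g = refl
listSum-tabulate {k = suc k} t g = cong (g (t zero) +_) (listSum-tabulate (t ∘ suc) g)

listSum-sum : ∀ {k} (g : Fin k → A → ℕ) (xs : List A) →
              listSum (λ x → sum (λ a → g a x)) xs ≡ sum (λ a → listSum (g a) xs)
listSum-sum {k = k} g []       = sym (sum-replicate-zero k)
listSum-sum         g (x ∷ xs) =
  trans (cong (sum (λ a → g a x) +_) (listSum-sum g xs)) (sym (∑-distrib-+ (λ a → g a x) (λ a → listSum (g a) xs)))

listSum-uniform : ∀ (g : A → ℕ) B v xs → All (λ x → B * g x ≡ v) xs → B * listSum g xs ≡ length xs * v
listSum-uniform g B v []       []       = *-zeroʳ B
listSum-uniform g B v (x ∷ xs) (e ∷ es) = trans (*-distribˡ-+ B (g x) _) (cong₂ _+_ e (listSum-uniform g B v xs es))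

length-filter : ∀ {p} {P : A → Set p} (P? : Decidable P) xs → length (filter P? xs) ≡ listSum (𝟙 ∘ P?) xs
length-filter P? []       = refl
length-filter P? (x ∷ xs) with does (P? x)
... | true  = cong suc (length-filter P? xs)
... | false = length-filter P? xs

-- Arithmetic for one layer of the double-counting induction: the layer
-- decomposition X + Y = W + T and the identity W + nY = F + R for the smaller
-- face combine to the identity for the layer.
layer-arith : ∀ X Y W T n F R → X + Y ≡ W + T → W + n * Y ≡ F + R → X + suc n * Y ≡ F + (T + R)
layer-arith X Y W T n F R e₁ e₂ = begin
  X + suc n * Y     ≡⟨ peel X Y n ⟩
  (X + Y) + n * Y   ≡⟨ cong (_+ n * Y) e₁ ⟩
  (W + T) + n * Y   ≡⟨ swap W T (n * Y) ⟩
  (W + n * Y) + T   ≡⟨ cong (_+ T) e₂ ⟩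
  (F + R) + T       ≡⟨ regroup F R T ⟩
  F + (T + R)       ∎
  where
  open ≡-Reasoning
  peel : ∀ X Y n → X + suc n * Y ≡ (X + Y) + n * Y
  peel = solve-∀
  swap : ∀ W T Z → (W + T) + Z ≡ (W + Z) + T
  swap = solve-∀
  regroup : ∀ F R T → (F + R) + T ≡ F + (T + R)
  regroup = solve-∀

-- Summing the layers: q·T extra vertices come with the newly freed coordinate.
free-arith : ∀ f q T R → f * q * T + (q * T + R) ≡ suc f * q * T + R
free-arith = solve-∀

-- Faces of the cube Z_q^n and sums over them.
module Faces (q : ℕ) where

  V : ℕ → Set
  V n = Vertex n q

  -- A face: 'just a' fixes a coordinate to a, 'nothing' leaves it free.
  Face : ℕ → Set
  Face n = Vec (Maybe (Fin q)) n

  free fixed : ∀ {n} → Face n → ℕ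
  free []            = 0
  free (nothing ∷ p) = suc (free p)
  free (just _ ∷ p)  = free p
  fixed []            = 0
  fixed (nothing ∷ p) = fixed p
  fixed (just _ ∷ p)  = suc (fixed p)

  free+fixed : ∀ {n} (p : Face n) → free p + fixed p ≡ n
  free+fixed []            = refl
  free+fixed (nothing ∷ p) = cong suc (free+fixed p)
  free+fixed (just _ ∷ p)  = trans (+-suc (free p) (fixed p)) (cong suc (free+fixed p))

  whole : ∀ n → Face n
  whole zero    = []
  whole (suc n) = nothing ∷ whole n

  faceSum : ∀ {n} → Face n → (V n → ℕ) → ℕ
  faceSum []           h = h []
  faceSum (nothing ∷ p) h = sum (λ a → faceSum p (λ xs → h (a ∷ xs)))
  faceSum (just a ∷ p)  h = faceSum p (λ xs → h (a ∷ xs))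

  faceSum-cong : ∀ {n} (p : Face n) {g h : V n → ℕ} → (∀ x → g x ≡ h x) → faceSum p g ≡ faceSum p h
  faceSum-cong []            e = e []
  faceSum-cong (nothing ∷ p) e = sum-cong-≗ (λ a → faceSum-cong p (λ xs → e (a ∷ xs)))
  faceSum-cong (just a ∷ p)  e = faceSum-cong p (λ xs → e (a ∷ xs))

  faceSum-+ : ∀ {n} (p : Face n) (g h : V n → ℕ) → faceSum p (λ x → g x + h x) ≡ faceSum p g + faceSum p h
  faceSum-+ []            g h = refl
  faceSum-+ (nothing ∷ p) g h =
    trans (sum-cong-≗ (λ a → faceSum-+ p (λ xs → g (a ∷ xs)) (λ xs → h (a ∷ xs))))
          (∑-distrib-+ (λ a → faceSum p (λ xs → g (a ∷ xs))) (λ a → faceSum p (λ xs → h (a ∷ xs))))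
  faceSum-+ (just a ∷ p)  g h = faceSum-+ p (λ xs → g (a ∷ xs)) (λ xs → h (a ∷ xs))

  faceSum-* : ∀ {n} (p : Face n) c (g : V n → ℕ) → faceSum p (λ x → c * g x) ≡ c * faceSum p g
  faceSum-* []            c g = refl
  faceSum-* (nothing ∷ p) c g =
    trans (sum-cong-≗ (λ a → faceSum-* p c (λ xs → g (a ∷ xs))))
          (sym (*-distribˡ-sum c (λ a → faceSum p (λ xs → g (a ∷ xs)))))
  faceSum-* (just a ∷ p)  c g = faceSum-* p c (λ xs → g (a ∷ xs))

  faceSum-const : ∀ {n} (p : Face n) c → faceSum p (λ _ → c) ≡ c * q ^ free p
  faceSum-const []            c = sym (*-identityʳ c)
  faceSum-const (nothing ∷ p) c =
    trans (sum-cong-≗ {q} (λ _ → faceSum-const p c))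
          (trans (sum-const q (c * q ^ free p)) (x∙yz≈y∙xz q c (q ^ free p)))
  faceSum-const (just a ∷ p)  c = faceSum-const p c

  -- The face fixing the first k coordinates to a (all of them if k ≥ n).
  prefixFace : Fin q → ∀ n → ℕ → Face n
  prefixFace a n       zero    = whole n
  prefixFace a zero    (suc k) = []
  prefixFace a (suc n) (suc k) = just a ∷ prefixFace a n k

  fixed-prefixFace : ∀ a n k → fixed (prefixFace a n k) ≤ k
  fixed-prefixFace a n       zero    = ≤-reflexive (fixed-whole n)
    where
    fixed-whole : ∀ n → fixed (whole n) ≡ 0
    fixed-whole zero    = refl
    fixed-whole (suc n) = fixed-whole n
  fixed-prefixFace a zero    (suc k) = z≤n
  fixed-prefixFace a (suc n) (suc k) = s≤s (fixed-prefixFace a n k)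

  free-prefixFace : ∀ a n k → free (prefixFace a n k) ≡ n ∸ k
  free-prefixFace a zero    zero    = refl
  free-prefixFace a (suc n) zero    = cong suc (free-prefixFace a n zero)
  free-prefixFace a zero    (suc k) = refl
  free-prefixFace a (suc n) (suc k) = free-prefixFace a n k

  faceSum-sum : ∀ {n k} (p : Face n) (g : Fin k → V n → ℕ) →
                faceSum p (λ x → sum (λ a → g a x)) ≡ sum (λ a → faceSum p (g a))
  faceSum-sum []            g = refl
  faceSum-sum (nothing ∷ p) g =
    trans (sum-cong-≗ {q} (λ b → faceSum-sum p (λ a xs → g a (b ∷ xs))))
          (∑-comm (λ b a → faceSum p (λ xs → g a (b ∷ xs))))
  faceSum-sum (just b ∷ p)  g = faceSum-sum p (λ a xs → g a (b ∷ xs))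

  listSum-allVertices : ∀ n (h : V n → ℕ) → listSum h (allVertices n q) ≡ faceSum (whole n) h
  listSum-allVertices zero    h = +-identityʳ (h [])
  listSum-allVertices (suc n) h = begin
    listSum h (concatMap row (toList (allFin q)))  ≡⟨ listSum-concatMap h row (toList (allFin q)) ⟩
    listSum (listSum h ∘ row) (toList (allFin q))  ≡⟨ listSum-tabulate (λ a → a) (listSum h ∘ row) ⟩
    sum (listSum h ∘ row)                          ≡⟨ sum-cong-≗ {q} rowSum ⟩
    faceSum (whole (suc n)) h                      ∎
    where
    open ≡-Reasoning
    row : Fin q → List (V (suc n))
    row a = map (a ∷_) (allVertices n q)
    rowSum : ∀ a → listSum h (row a) ≡ faceSum (whole n) (λ xs → h (a ∷ xs))
    rowSum a = trans (listSum-map h (a ∷_) (allVertices n q)) (listSum-allVertices n (λ xs → h (a ∷ xs)))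

  sum-dist₀ : ∀ {n} (x : V n) (g : V n → ℕ) → faceSum (whole n) (λ y → 𝟙 (dist x y ≟ 0) * g y) ≡ g x
  sum-dist₀ []       g = +-identityʳ (g [])
  sum-dist₀ (a ∷ xs) g = trans (sum-cong-≗ {q} row) (sum-δ a (λ b → g (b ∷ xs)))
    where
    row : ∀ b → faceSum (whole _) (λ ys → 𝟙 (dist (a ∷ xs) (b ∷ ys) ≟ 0) * g (b ∷ ys))
              ≡ 𝟙 (a Fin.≟ b) * g (b ∷ xs)
    row b with a Fin.≟ b
    ... | yes refl = trans (sum-dist₀ xs (λ ys → g (a ∷ ys))) (sym (+-identityʳ _))
    ... | no _     = faceSum-* (whole _) 0 (λ ys → g (b ∷ ys))

  neighbourSum : ∀ n → (V n → ℕ) → V n → ℕ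
  neighbourSum n h x = faceSum (whole n) (λ y → 𝟙 (dist x y ≟ 1) * h y)

  neighbourSum-+ : ∀ n (g h : V n → ℕ) x →
                   neighbourSum n (λ y → g y + h y) x ≡ neighbourSum n g x + neighbourSum n h x
  neighbourSum-+ n g h x =
    trans (faceSum-cong (whole n) (λ y → *-distribˡ-+ (𝟙 (dist x y ≟ 1)) (g y) (h y)))
          (faceSum-+ (whole n) (λ y → 𝟙 (dist x y ≟ 1) * g y) (λ y → 𝟙 (dist x y ≟ 1) * h y))

  nbrsOfColour≡neighbourSum : ∀ {n k} (f : V n → Fin k) x j →
                              nbrsOfColour f x j ≡ neighbourSum n (λ y → 𝟙 (f y Fin.≟ j)) x
  nbrsOfColour≡neighbourSum {n} f x j =
    trans (length-filter (λ y → adjacent? x y ×-dec (f y Fin.≟ j)) (allVertices n q))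
          (trans (listSum-allVertices n _)
                 (faceSum-cong (whole n) (λ y → 𝟙-× (adjacent? x y) (f y Fin.≟ j))))

  -- The neighbours of a ∷ xs are the a ∷ ys with ys ~ xs together with the
  -- b ∷ xs for b ≠ a; adding a ∷ xs itself completes the latter to a full line.
  neighbourSum-∷ : ∀ {n} (h : V (suc n) → ℕ) a (xs : V n) →
                   neighbourSum (suc n) h (a ∷ xs) + h (a ∷ xs)
                   ≡ neighbourSum n (λ ys → h (a ∷ ys)) xs + sum (λ b → h (b ∷ xs))
  neighbourSum-∷ {n} h a xs = begin
    sum T + h (a ∷ xs)                           ≡⟨ cong (sum T +_) (sym (sum-δ a line)) ⟩
    sum T + sum (λ b → δ b * line b)              ≡⟨ sym (∑-distrib-+ T (λ b → δ b * line b)) ⟩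
    sum (λ b → T b + δ b * line b)                ≡⟨ sum-cong-≗ {q} row ⟩
    sum (λ b → δ b * inner + line b)              ≡⟨ ∑-distrib-+ (λ b → δ b * inner) line ⟩
    sum (λ b → δ b * inner) + sum line            ≡⟨ cong (_+ sum line) (sum-δ a (λ _ → inner)) ⟩
    inner + sum line                              ∎
    where
    open ≡-Reasoning
    T line : Fin q → ℕ
    T b    = faceSum (whole n) (λ ys → 𝟙 (dist (a ∷ xs) (b ∷ ys) ≟ 1) * h (b ∷ ys))
    line b = h (b ∷ xs)
    δ : Fin q → ℕ
    δ b = 𝟙 (a Fin.≟ b)
    inner : ℕ
    inner = neighbourSum n (λ ys → h (a ∷ ys)) xs
    row : ∀ b → T b + δ b * line b ≡ δ b * inner + line b
    row b with a Fin.≟ b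
    ... | yes refl = trans (cong (inner +_) (+-identityʳ (line a))) (cong (_+ line a) (sym (+-identityʳ inner)))
    ... | no _     = trans (+-identityʳ _) (sum-dist₀ xs (λ ys → h (b ∷ ys)))

  -- Every vertex has n(q-1) neighbours (stated additively: degree + n = n·q).
  degree : ∀ n (x : V n) → neighbourSum n (λ _ → 1) x + n ≡ n * q
  degree zero    []       = refl
  degree (suc n) (a ∷ xs) = shift (neighbourSum (suc n) (λ _ → 1) (a ∷ xs)) inner (n * q) split (degree n xs)
    where
    inner : ℕ
    inner = neighbourSum n (λ _ → 1) xs
    split : neighbourSum (suc n) (λ _ → 1) (a ∷ xs) + 1 ≡ inner + q
    split = trans (neighbourSum-∷ (λ _ → 1) a xs) (cong (inner +_) (trans (sum-const q 1) (*-identityʳ q)))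
    shift : ∀ X Y t → X + 1 ≡ Y + q → Y + n ≡ t → X + suc n ≡ q + t
    shift X Y t e₁ e₂ = begin
      X + suc n      ≡⟨ sym (+-assoc X 1 n) ⟩
      (X + 1) + n    ≡⟨ cong (_+ n) e₁ ⟩
      (Y + q) + n    ≡⟨ trans (cong (_+ n) (+-comm Y q)) (+-assoc q Y n) ⟩
      q + (Y + n)    ≡⟨ cong (q +_) e₂ ⟩
      q + t          ∎
      where open ≡-Reasoning

  releases : ∀ {n} → Face n → List (Face n)
  releases []            = []
  releases (nothing ∷ p) = map (nothing ∷_) (releases p)
  releases (just a ∷ p)  = (nothing ∷ p) ∷ map (just a ∷_) (releases p)

  releases-shape : ∀ {n} (p : Face n) →
                   All (λ p′ → suc (fixed p′) ≡ fixed p × free p′ ≡ suc (free p)) (releases p)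
  releases-shape []            = []
  releases-shape (nothing ∷ p) =
    All.map⁺ (All.map (λ { (fixed≡ , free≡) → fixed≡ , cong suc free≡ }) (releases-shape p))
  releases-shape (just a ∷ p)  =
    (refl , refl) ∷ All.map⁺ (All.map (λ { (fixed≡ , free≡) → cong suc fixed≡ , free≡ }) (releases-shape p))

  length-releases : ∀ {n} (p : Face n) → length (releases p) ≡ fixed p
  length-releases []            = refl
  length-releases (nothing ∷ p) = trans (length-map (nothing ∷_) (releases p)) (length-releases p)
  length-releases (just a ∷ p)  = cong suc (trans (length-map (just a ∷_) (releases p)) (length-releases p))

  releaseSum : ∀ {n} → Face n → (V n → ℕ) → ℕ
  releaseSum p h = listSum (λ p′ → faceSum p′ h) (releases p)

  -- Double counting of the edges at a face p: every vertex of p has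
  -- (free p)(q-1) neighbours inside p, and each edge leaving p ends in exactly
  -- one of the released faces.
  DoubleCounting : ∀ {n} → Face n → (V n → ℕ) → Set
  DoubleCounting {n} p h = faceSum p (neighbourSum n h) + n * faceSum p h ≡ free p * q * faceSum p h + releaseSum p h

  -- Passing from p to the layer {a} × p of the face (·) ∷ p.
  layer : ∀ {n} (p : Face n) (h : V (suc n) → ℕ) a → DoubleCounting p (λ xs → h (a ∷ xs)) →
          faceSum p (λ xs → neighbourSum (suc n) h (a ∷ xs)) + suc n * faceSum p (λ xs → h (a ∷ xs))
          ≡ free p * q * faceSum p (λ xs → h (a ∷ xs)) + (faceSum (nothing ∷ p) h + releaseSum p (λ xs → h (a ∷ xs)))
  layer {n} p h a = layer-arith _ _ _ _ n (free p * q * faceSum p hₐ) (releaseSum p hₐ) split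
    where
    hₐ : V n → ℕ
    hₐ xs = h (a ∷ xs)
    split : faceSum p (λ xs → neighbourSum (suc n) h (a ∷ xs)) + faceSum p hₐ
            ≡ faceSum p (neighbourSum n hₐ) + faceSum (nothing ∷ p) h
    split = begin
      faceSum p (λ xs → neighbourSum (suc n) h (a ∷ xs)) + faceSum p hₐ
        ≡⟨ sym (faceSum-+ p (λ xs → neighbourSum (suc n) h (a ∷ xs)) hₐ) ⟩
      faceSum p (λ xs → neighbourSum (suc n) h (a ∷ xs) + hₐ xs)
        ≡⟨ faceSum-cong p (neighbourSum-∷ h a) ⟩
      faceSum p (λ xs → neighbourSum n hₐ xs + sum (λ b → h (b ∷ xs)))
        ≡⟨ faceSum-+ p (neighbourSum n hₐ) (λ xs → sum (λ b → h (b ∷ xs))) ⟩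
      faceSum p (neighbourSum n hₐ) + faceSum p (λ xs → sum (λ b → h (b ∷ xs)))
        ≡⟨ cong (faceSum p (neighbourSum n hₐ) +_) (faceSum-sum p (λ b xs → h (b ∷ xs))) ⟩
      faceSum p (neighbourSum n hₐ) + faceSum (nothing ∷ p) h
        ∎
      where open ≡-Reasoning

  doubleCounting : ∀ {n} (p : Face n) (h : V n → ℕ) → DoubleCounting p h
  doubleCounting []            h = refl
  doubleCounting (just a ∷ p)  h =
    trans (layer p h a (doubleCounting p (λ xs → h (a ∷ xs))))
          (cong (λ r → free p * q * faceSum p (λ xs → h (a ∷ xs)) + (faceSum (nothing ∷ p) h + r))
                (sym (listSum-map (λ p′ → faceSum p′ h) (just a ∷_) (releases p))))
  doubleCounting {suc n} (nothing ∷ p) h = begin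
    sum X + suc n * T
      ≡⟨ cong (sum X +_) (*-distribˡ-sum (suc n) Y) ⟩
    sum X + sum (λ a → suc n * Y a)
      ≡⟨ sym (∑-distrib-+ X (λ a → suc n * Y a)) ⟩
    sum (λ a → X a + suc n * Y a)
      ≡⟨ sum-cong-≗ {q} (λ a → layer p h a (doubleCounting p (λ xs → h (a ∷ xs)))) ⟩
    sum (λ a → free p * q * Y a + (T + Rₐ a))
      ≡⟨ ∑-distrib-+ (λ a → free p * q * Y a) (λ a → T + Rₐ a) ⟩
    sum (λ a → free p * q * Y a) + sum (λ a → T + Rₐ a)
      ≡⟨ cong₂ _+_ (sym (*-distribˡ-sum (free p * q) Y))
                   (trans (∑-distrib-+ (λ _ → T) Rₐ) (cong (_+ sum Rₐ) (sum-const q T))) ⟩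
    free p * q * T + (q * T + sum Rₐ)
      ≡⟨ free-arith (free p) q T (sum Rₐ) ⟩
    suc (free p) * q * T + sum Rₐ
      ≡⟨ cong (suc (free p) * q * T +_) (sym releaseSum-layers) ⟩
    suc (free p) * q * T + releaseSum (nothing ∷ p) h
      ∎
    where
    open ≡-Reasoning
    X Y Rₐ : Fin q → ℕ
    X a  = faceSum p (λ xs → neighbourSum (suc n) h (a ∷ xs))
    Y a  = faceSum p (λ xs → h (a ∷ xs))
    Rₐ a = releaseSum p (λ xs → h (a ∷ xs))
    T : ℕ
    T = sum Y
    releaseSum-layers : releaseSum (nothing ∷ p) h ≡ sum Rₐ
    releaseSum-layers =
      trans (listSum-map (λ p′ → faceSum p′ h) (nothing ∷_) (releases p))
            (listSum-sum (λ a p′ → faceSum p′ (λ xs → h (a ∷ xs))) (releases p))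

-- Combining the double-counting identity with the summed colouring condition.
balance-arith : ∀ X N R P B c f j m →
                X + (f + j) * N ≡ f * suc m * N + R →
                X + B * N ≡ (f + j) * m * N + c * P →
                B * N + R ≡ j * suc m * N + c * P
balance-arith X N R P B c f j m dc col = +-cancelˡ-≡ (X + (f + j) * N) _ _ (begin
  (X + (f + j) * N) + (B * N + R)            ≡⟨ regroup X ((f + j) * N) (B * N) R ⟩
  (X + B * N) + (R + (f + j) * N)            ≡⟨ cong (_+ (R + (f + j) * N)) col ⟩
  ((f + j) * m * N + c * P) + (R + (f + j) * N) ≡⟨ redistribute f j m N c P R ⟩
  (f * suc m * N + R) + (j * suc m * N + c * P) ≡⟨ cong (_+ (j * suc m * N + c * P)) (sym dc) ⟩
  (X + (f + j) * N) + (j * suc m * N + c * P) ∎)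
  where
  open ≡-Reasoning
  regroup : ∀ X F Z R → (X + F) + (Z + R) ≡ (X + Z) + (R + F)
  regroup = solve-∀
  redistribute : ∀ f j m N c P R →
                 ((f + j) * m * N + c * P) + (R + (f + j) * N) ≡ (f * suc m * N + R) + (j * suc m * N + c * P)
  redistribute = solve-∀

cross-cancel : ∀ {B k} Z W → k < B → B * Z + k * W ≡ k * Z + B * W → Z ≡ W
cross-cancel {B} {k} Z W k<B =
  subst (λ B → B * Z + k * W ≡ k * Z + B * W → Z ≡ W) (m+[n∸m]≡n (<⇒≤ k<B))
        (cancel (B ∸ k) {{>-nonZero (m<n⇒0<n∸m k<B)}})
  where
  cancel : ∀ e .{{_ : NonZero e}} → (k + e) * Z + k * W ≡ k * Z + (k + e) * W → Z ≡ W
  cancel e eq = *-cancelˡ-≡ Z W e (+-cancelˡ-≡ (k * Z + k * W) _ _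
    (trans (expandˡ k e Z W) (trans eq (expandʳ k e Z W))))
    where
    expandˡ : ∀ k e Z W → (k * Z + k * W) + e * Z ≡ (k + e) * Z + k * W
    expandˡ = solve-∀
    expandʳ : ∀ k e Z W → k * Z + (k + e) * W ≡ (k * Z + k * W) + e * W
    expandʳ = solve-∀

-- One induction step of the density statement, in purely arithmetic form:
-- from the balance of a face and the known value of its release sum.
density-arith : ∀ B j q N R c P → j * q < B →
                B * N + R ≡ j * q * N + c * P → B * R ≡ j * (c * (q * P)) → B * N ≡ c * P
density-arith B j q N R c P small balance released = cross-cancel (B * N) (c * P) small (begin
  B * (B * N) + j * q * (c * P)   ≡⟨ cong (B * (B * N) +_) (trans (reassoc j q c P) (sym released)) ⟩
  B * (B * N) + B * R             ≡⟨ sym (*-distribˡ-+ B (B * N) R) ⟩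
  B * (B * N + R)                 ≡⟨ cong (B *_) balance ⟩
  B * (j * q * N + c * P)         ≡⟨ spread B j q N c P ⟩
  j * q * (B * N) + B * (c * P)   ∎)
  where
  open ≡-Reasoning
  reassoc : ∀ j q c P → j * q * (c * P) ≡ j * (c * (q * P))
  reassoc = solve-∀
  spread : ∀ B j q N c P → B * (j * q * N + c * P) ≡ j * q * (B * N) + B * (c * P)
  spread = solve-∀

colours-partition : ∀ (i : Fin 2) → 𝟙 (i Fin.≟ zero) + 𝟙 (i Fin.≟ suc zero) ≡ 1
colours-partition zero       = refl
colours-partition (suc zero) = refl

-- A (b,c)-colouring of H(n,q), q = suc m, given by its regularity condition.
module BCColouring (m n b c : ℕ) (f : Vertex n (suc m) → Fin 2)
                   (regular : ∀ x j → nbrsOfColour f x j ≡ bcMatrix n (suc m) b c (f x) j) where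

  q : ℕ
  q = suc m

  open Faces q public

  B : ℕ
  B = b + c

  colour : Fin 2 → V n → ℕ
  colour j y = 𝟙 (f y Fin.≟ j)

  F : V n → ℕ
  F = colour zero

  colour-counts : ∀ x → neighbourSum n F x + neighbourSum n (colour (suc zero)) x ≡ n * m
  colour-counts x = +-cancelʳ-≡ n _ _ (begin
    neighbourSum n F x + neighbourSum n (colour (suc zero)) x + n
      ≡⟨ cong (_+ n) (sym (neighbourSum-+ n F (colour (suc zero)) x)) ⟩
    neighbourSum n (λ y → F y + colour (suc zero) y) x + n
      ≡⟨ cong (_+ n) (faceSum-cong (whole n) (λ y → cong (𝟙 (dist x y ≟ 1) *_) (colours-partition (f y)))) ⟩
    neighbourSum n (λ _ → 1) x + n
      ≡⟨ degree n x ⟩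
    n * suc m
      ≡⟨ trans (*-suc n m) (+-comm n (n * m)) ⟩
    n * m + n
      ∎)
    where open ≡-Reasoning

  -- The regularity condition, restated without truncated subtraction:
  -- (neighbours of colour 1) + B·[x has colour 1] = n(q-1)·[x has colour 1] + c.
  vertex-balance : ∀ x → neighbourSum n F x + B * F x ≡ n * m * F x + c
  vertex-balance x = by-colour (f x) refl
    where
    count : ∀ {i} → f x ≡ i → ∀ j → neighbourSum n (colour j) x ≡ bcMatrix n q b c i j
    count fx j = trans (sym (nbrsOfColour≡neighbourSum f x j)) (trans (regular x j) (cong (λ i → bcMatrix n q b c i j) fx))
    by-colour : ∀ i → f x ≡ i → neighbourSum n F x + B * F x ≡ n * m * F x + c
    by-colour zero       fx rewrite fx =
      colour₁ (neighbourSum n F x) (n * m)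
              (trans (cong (neighbourSum n F x +_) (sym (count fx (suc zero)))) (colour-counts x))
      where
      colour₁ : ∀ Y D → Y + b ≡ D → Y + (b + c) * 1 ≡ D * 1 + c
      colour₁ Y D e = trans (shape Y b c) (trans (cong (_+ c) e) (cong (_+ c) (sym (*-identityʳ D))))
        where
        shape : ∀ Y b c → Y + (b + c) * 1 ≡ (Y + b) + c
        shape = solve-∀
    by-colour (suc zero) fx rewrite fx =
      trans (cong (_+ B * 0) (count fx zero)) (trans (cong (c +_) (*-zeroʳ B)) (trans (+-identityʳ c) (cong (_+ c) (sym (*-zeroʳ (n * m))))))

  face-balance : ∀ (p : Face n) →
                 B * faceSum p F + releaseSum p F ≡ fixed p * q * faceSum p F + c * q ^ free p
  face-balance p =
    balance-arith (faceSum p (neighbourSum n F)) (faceSum p F) (releaseSum p F) (q ^ free p) B c (free p) (fixed p) m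
      (subst (λ k → faceSum p (neighbourSum n F) + k * faceSum p F ≡ free p * q * faceSum p F + releaseSum p F)
             (sym (free+fixed p)) (doubleCounting p F))
      (subst (λ k → faceSum p (neighbourSum n F) + B * faceSum p F ≡ k * m * faceSum p F + c * q ^ free p)
             (sym (free+fixed p)) summed)
    where
    open ≡-Reasoning
    summed : faceSum p (neighbourSum n F) + B * faceSum p F ≡ n * m * faceSum p F + c * q ^ free p
    summed = begin
      faceSum p (neighbourSum n F) + B * faceSum p F
        ≡⟨ cong (faceSum p (neighbourSum n F) +_) (sym (faceSum-* p B F)) ⟩
      faceSum p (neighbourSum n F) + faceSum p (λ x → B * F x)
        ≡⟨ sym (faceSum-+ p (neighbourSum n F) (λ x → B * F x)) ⟩
      faceSum p (λ x → neighbourSum n F x + B * F x)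
        ≡⟨ faceSum-cong p vertex-balance ⟩
      faceSum p (λ x → n * m * F x + c)
        ≡⟨ faceSum-+ p (λ x → n * m * F x) (λ _ → c) ⟩
      faceSum p (λ x → n * m * F x) + faceSum p (λ _ → c)
        ≡⟨ cong₂ _+_ (faceSum-* p (n * m) F) (faceSum-const p c) ⟩
      n * m * faceSum p F + c * q ^ free p
        ∎

  DensityAt : Face n → Set
  DensityAt p = B * faceSum p F ≡ c * q ^ free p

  density-step : ∀ (p : Face n) → fixed p * q < B →
                 (∀ p′ → suc (fixed p′) ≡ fixed p → DensityAt p′) → DensityAt p
  density-step p small ih =
    density-arith B (fixed p) q (faceSum p F) (releaseSum p F) c (q ^ free p) small (face-balance p) released
    where
    released : B * releaseSum p F ≡ fixed p * (c * (q * q ^ free p))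
    released =
      trans (listSum-uniform (λ p′ → faceSum p′ F) B (c * q ^ suc (free p)) (releases p)
               (All.map (λ { {p′} (fixed≡ , free≡) → trans (ih p′ fixed≡) (cong (λ t → c * q ^ t) free≡) })
                        (releases-shape p)))
            (cong (_* (c * q ^ suc (free p))) (length-releases p))

  density : ∀ k (p : Face n) → fixed p ≡ k → k * q < B → DensityAt p
  density zero    p fixed≡0 small =
    density-step p (subst (λ j → j * q < B) (sym fixed≡0) small)
                 (λ p′ suc≡ → ⊥-elim (1+n≢0 (trans suc≡ fixed≡0)))
  density (suc k) p fixed≡ small =
    density-step p (subst (λ j → j * q < B) (sym fixed≡) small)
                 (λ p′ suc≡ → density k p′ (suc-injective (trans suc≡ fixed≡)) (≤-<-trans (m≤n+m (k * q) q) small))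

  prefix-density : ∀ k → k * q < B → B * faceSum (prefixFace zero n k) F ≡ c * q ^ (n ∸ k)
  prefix-density k small =
    trans (density (fixed p) p refl (≤-<-trans (*-monoˡ-≤ q (fixed-prefixFace zero n k)) small))
          (cong (λ t → c * q ^ t) (free-prefixFace zero n k))
    where
    p : Face n
    p = prefixFace zero n k

-- If (b + c)·N = c·Q then b′ + c′ ∣ Q for b′ = b / gcd(b,c), c′ = c / gcd(b,c):
-- cancelling gcd(b,c) gives (b′ + c′)·N = c′·Q, and b′ + c′ is coprime to c′.
reduced-sum-∣ : ∀ b c N Q .{{_ : NonZero (gcd b c)}} → (b + c) * N ≡ c * Q → (b / gcd b c + c / gcd b c) ∣ Q
reduced-sum-∣ b c N Q eq = coprime-divisor coprime (divides N (sym (trans (*-comm N (b′ + c′)) reduced)))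
  where
  open ≡-Reasoning
  g b′ c′ : ℕ
  g  = gcd b c
  b′ = b / g
  c′ = c / g
  reduced : (b′ + c′) * N ≡ c′ * Q
  reduced = *-cancelʳ-≡ _ _ g (begin
    (b′ + c′) * N * g      ≡⟨ distribute b′ c′ N g ⟩
    (b′ * g + c′ * g) * N  ≡⟨ cong₂ (λ u v → (u + v) * N) (m/n*n≡m (gcd[m,n]∣m b c)) (m/n*n≡m (gcd[m,n]∣n b c)) ⟩
    (b + c) * N            ≡⟨ eq ⟩
    c * Q                  ≡⟨ cong (_* Q) (sym (m/n*n≡m (gcd[m,n]∣n b c))) ⟩
    c′ * g * Q             ≡⟨ *-right-comm c′ g Q ⟩
    c′ * Q * g             ∎)
    where
    distribute : ∀ b′ c′ N g → (b′ + c′) * N * g ≡ (b′ * g + c′ * g) * N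
    distribute = solve-∀
    *-right-comm : ∀ x y z → x * y * z ≡ x * z * y
    *-right-comm = solve-∀
  coprime : Coprime (b′ + c′) c′
  coprime = subst (λ t → Coprime t c′) (+-comm c′ b′) (coprime-+ (coprime-/gcd b c))

^-monoʳ-∣ : ∀ q {a b} → a ≤ b → q ^ a ∣ q ^ b
^-monoʳ-∣ q {a} {b} a≤b =
  subst (λ e → q ^ a ∣ q ^ e) (m+[n∸m]≡n a≤b)
        (subst (q ^ a ∣_) (sym (^-distribˡ-+-* q a (b ∸ a))) (m∣m*n (q ^ (b ∸ a))))

-- Fixing pred ⌊m/n⌋ coordinates is allowed in (★): pred ⌊m/n⌋ · n < m.
pred[m/n]*n<m : ∀ m n .{{_ : NonZero n}} → 0 < m → pred (m / n) * n < m
pred[m/n]*n<m m n 0<m with m / n | m/n*n≤m m n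
... | zero  | _      = 0<m
... | suc i | i*n≤m  = <-≤-trans (m<n+m (i * n) (>-nonZero⁻¹ n)) i*n≤m

-- The exponent n - pred i obtained from (★) is at most the claimed n + 1 - i.
exponent-bound : ∀ n i → n ∸ pred i ≤ n + 1 ∸ i
exponent-bound n zero    = m≤m+n n 1
exponent-bound n (suc i) = ≤-reflexive (cong (_∸ suc i) (+-comm 1 n))

theorem1 : (n q : ℕ) → .{{_ : NonZero q}} → 1 ≤ n → 2 ≤ q → (b c : ℕ) → (f : Vertex n q → Fin 2)
    → (bc : IsBCColouring b c f)
    → let b≥1 = proj₁ bc in
      (reduceBy b c b b≥1 + reduceBy b c c b≥1) ∣ q ^ (n + 1 ∸ (b + c) / q)
theorem1 n zero    _ ()
theorem1 n (suc m) _ _ zero      c f (() , _)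
theorem1 n (suc m) _ _ b@(suc _) c f (_ , _ , _ , regular) =
  ∣-trans (reduced-sum-∣ b c (faceSum (prefixFace zero n k) F) (q ^ (n ∸ k)) {{gcd≢0}}
                         (prefix-density k (pred[m/n]*n<m B q (s≤s z≤n))))
          (^-monoʳ-∣ q (exponent-bound n (B / q)))
  where
  open BCColouring m n b c f regular
  k : ℕ
  k = pred (B / q)
  gcd≢0 : NonZero (gcd b c)
  gcd≢0 = ≢-nonZero (gcd[m,n]≢0 b c (inj₁ (λ ())))
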